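{- Let $s,s'$ be integers with $0<s'<s$, let $G$ be an $(s,s')^*$-dismantlable graph, and let $c=(v_0,v_1,\ldots,v_{n-1},v_0)$ be a loop of $G$ of length $n>2(s+s')$. Then $c$ contains two vertices $x=v_p$, $y=v_q$ with $q-p\equiv 2s \pmod n$ and $d(x,y)\le 2s'$.
   Context: Graphs are undirected, connected, simple, possibly infinite; $d$ is the shortest-path distance; $B_r(v,G)=\{x: d(v,x)\le r\}$. A loop is a sequence of vertices $(v_0,v_1,\ldots,v_{n-1},v_0)$ such that for each $i$ (indices mod $n$) either $v_i=v_{i+1}$ or $v_iv_{i+1}$ is an edge; $n$ is its length. For a well-order $\preceq$ on $V$, $X_v=\{w: w\preceq v\}$. $G$ is $(s,s')^*$-dismantlable if $V$ admits a well-order $\preceq$ such that for each vertex $v$ (other than the least element) there is $u\ne v$, $u\preceq v$, with $B_s(v,G)\cap X_v\subseteq B_{s'}(u,G)$. -}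

module Defs where

open import Data.Nat using (ℕ; zero; suc; _+_; _*_; _≤_; _<_)
open import Data.Fin using (Fin; toℕ)
open import Data.Product using (Σ; _×_; _,_; ∃)
open import Data.Sum using (_⊎_)
open import Relation.Nullary using (¬_)
open import Relation.Binary.PropositionalEquality using (_≡_; _≢_)
open import Induction.WellFounded using (WellFounded)

data Walk {V : Set} (E : V → V → Set) : V → V → ℕ → Set where
  nil  : ∀ {x} → Walk E x x 0
  cons : ∀ {x y z k} → E x y → Walk E y z k → Walk E x z (suc k)

record Graph : Set₁ where
  field
    V      : Set
    E      : V → V → Set
    sym    : ∀ {x y} → E x y → E y x
    irrefl : ∀ {x} → ¬ E x x
    connected : ∀ x y → ∃ λ k → Walk E x y k

open Graph public

dist≤ : (G : Graph) → V G → V G → ℕ → Set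
dist≤ G x y r = Σ ℕ λ k → k ≤ r × Walk (E G) x y k

record IsWellOrder {A : Set} (_≺_ : A → A → Set) : Set where
  field
    irrefl    : ∀ {x} → ¬ (x ≺ x)
    trans     : ∀ {x y z} → x ≺ y → y ≺ z → x ≺ z
    trichot   : ∀ x y → (x ≺ y) ⊎ (x ≡ y) ⊎ (y ≺ x)
    wellFounded : WellFounded _≺_

Dismantlable : ℕ → ℕ → Graph → Set₁
Dismantlable s s′ G =
  Σ (V G → V G → Set) λ _≺_ →
    IsWellOrder _≺_ ×
    (let _≼_ = λ w v → (w ≺ v) ⊎ (w ≡ v) in
     ∀ v → (∃ λ w → w ≺ v) →
       ∃ λ u → u ≢ v × u ≼ v ×
         (∀ w → w ≼ v → dist≤ G v w s → dist≤ G u w s′))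

SuccMod : (n : ℕ) → Fin n → Fin n → Set
SuccMod n i j = (suc (toℕ i) ≡ toℕ j) ⊎ ((suc (toℕ i) ≡ n) × (toℕ j ≡ 0))

IsLoop : (G : Graph) (n : ℕ) → (Fin n → V G) → Set
IsLoop G n c = ∀ (i j : Fin n) → SuccMod n i j → (c i ≡ c j) ⊎ E G (c i) (c j)

_≡_[mod_] : ℕ → ℕ → ℕ → Set
a ≡ b [mod n ] = ∃ λ k → ∃ λ l → a + k * n ≡ b + l * n

module Submission where

-- Let v = c i be the largest vertex of the loop in the dismantling order, and let
-- p = i − s, q = i + s.  Both c p and c q lie within distance s of v and precede it,
-- so the vertex u that dismantles v (if v is not the least vertex) is within s′ of
-- both, giving d(c p, c q) ≤ 2s′; if v is the least vertex then c p = v = c q.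

open import Defs hiding (sym)
open import Data.Nat using (ℕ; zero; suc; _+_; _*_; _<_; z≤n; s≤s)
open import Data.Nat.Properties using (+-comm; +-identityʳ; +-mono-≤; _≟_; ≤∧≢⇒<)
open import Data.Nat.GeneralisedArithmetic using (fold; iterate)
open import Data.Nat.Tactic.RingSolver using (solve-∀)
open import Data.Fin using (Fin; toℕ; fromℕ; fromℕ<; inject₁) renaming (zero to fzero; suc to fsuc)
open import Data.Fin.Properties using (toℕ-fromℕ; toℕ-fromℕ<; toℕ-inject₁; toℕ≤pred[n])
open import Data.Product using (∃; _×_; _,_; proj₁; proj₂)
open import Data.Sum using (_⊎_; inj₁; inj₂)
open import Relation.Nullary using (yes; no)
open import Relation.Binary.PropositionalEquality
  using (_≡_; refl; sym; trans; cong; subst; module ≡-Reasoning)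

module _ {V : Set} {E : V → V → Set} where

  infixr 5 _++ʷ_

  _++ʷ_ : ∀ {x y z k j} → Walk E x y k → Walk E y z j → Walk E x z (k + j)
  nil      ++ʷ w′ = w′
  cons e w ++ʷ w′ = cons e (w ++ʷ w′)

  reverseʷ : (∀ {x y} → E x y → E y x) → ∀ {x y k} → Walk E x y k → Walk E y x k
  reverseʷ E-sym nil = nil
  reverseʷ E-sym (cons {k = k} e w) =
    subst (Walk E _ _) (+-comm k 1) (reverseʷ E-sym w ++ʷ cons (E-sym e) nil)

module Distance (G : Graph) where

  dist≤-refl : ∀ {x r} → dist≤ G x x r
  dist≤-refl = 0 , z≤n , nil

  dist≤-sym : ∀ {x y r} → dist≤ G x y r → dist≤ G y x r
  dist≤-sym (k , k≤r , w) = k , k≤r , reverseʷ (Graph.sym G) w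

  dist≤-trans : ∀ {x y z r r′} → dist≤ G x y r → dist≤ G y z r′ → dist≤ G x z (r + r′)
  dist≤-trans (k , k≤r , w) (j , j≤r′ , w′) = k + j , +-mono-≤ k≤r j≤r′ , w ++ʷ w′

  dist≤-step : ∀ {x y} → (x ≡ y) ⊎ E G x y → dist≤ G x y 1
  dist≤-step (inj₁ refl) = 0 , z≤n , nil
  dist≤-step (inj₂ e)    = 1 , s≤s z≤n , cons e nil

≡+[mod]-trans : ∀ {n x y z a b} →
  y ≡ x + a [mod n ] → z ≡ y + b [mod n ] → z ≡ x + (a + b) [mod n ]
≡+[mod]-trans {n} {x} {y} {z} {a} {b} (k₁ , l₁ , e₁) (k₂ , l₂ , e₂) = k₂ + k₁ , l₁ + l₂ , (begin
  z + (k₂ + k₁) * n          ≡⟨ shuffle₁ z k₂ k₁ n ⟩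
  (z + k₂ * n) + k₁ * n      ≡⟨ cong (_+ k₁ * n) e₂ ⟩
  (y + b + l₂ * n) + k₁ * n  ≡⟨ shuffle₂ y b l₂ k₁ n ⟩
  (y + k₁ * n) + b + l₂ * n  ≡⟨ cong (λ t → t + b + l₂ * n) e₁ ⟩
  (x + a + l₁ * n) + b + l₂ * n ≡⟨ shuffle₃ x a l₁ b l₂ n ⟩
  x + (a + b) + (l₁ + l₂) * n ∎)
  where
  open ≡-Reasoning
  shuffle₁ : ∀ z k₂ k₁ n → z + (k₂ + k₁) * n ≡ (z + k₂ * n) + k₁ * n
  shuffle₁ = solve-∀
  shuffle₂ : ∀ y b l₂ k₁ n → (y + b + l₂ * n) + k₁ * n ≡ (y + k₁ * n) + b + l₂ * n
  shuffle₂ = solve-∀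
  shuffle₃ : ∀ x a l₁ b l₂ n → (x + a + l₁ * n) + b + l₂ * n ≡ x + (a + b) + (l₁ + l₂) * n
  shuffle₃ = solve-∀

SuccMod⇒≡+1[mod] : ∀ {n} {i j : Fin n} → SuccMod n i j → toℕ j ≡ toℕ i + 1 [mod n ]
SuccMod⇒≡+1[mod] {i = i} (inj₁ e) = 0 , 0 , cong (_+ 0) (trans (sym e) (+-comm 1 (toℕ i)))
SuccMod⇒≡+1[mod] {i = i} (inj₂ (e , j≡0)) rewrite j≡0 =
  1 , 0 , cong (_+ 0) (trans (sym e) (+-comm 1 (toℕ i)))

sucMod : ∀ {m} → Fin (suc m) → Fin (suc m)
sucMod {m} i with toℕ i ≟ m
... | yes _  = fzero
... | no i≢m = fromℕ< (s≤s (≤∧≢⇒< (toℕ≤pred[n] i) i≢m))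

SuccMod-sucMod : ∀ {m} (i : Fin (suc m)) → SuccMod (suc m) i (sucMod i)
SuccMod-sucMod {m} i with toℕ i ≟ m
... | yes i≡m = inj₂ (cong suc i≡m , refl)
... | no i≢m  = inj₁ (sym (toℕ-fromℕ< (s≤s (≤∧≢⇒< (toℕ≤pred[n] i) i≢m))))

predMod : ∀ {m} → Fin (suc m) → Fin (suc m)
predMod {m} fzero = fromℕ m
predMod (fsuc i)  = inject₁ i

SuccMod-predMod : ∀ {m} (i : Fin (suc m)) → SuccMod (suc m) (predMod i) i
SuccMod-predMod {m} fzero = inj₂ (cong suc (toℕ-fromℕ m) , refl)
SuccMod-predMod (fsuc i)  = inj₁ (cong suc (toℕ-inject₁ i))

module LoopPaths (G : Graph) {n : ℕ} (c : Fin n → V G) (loop : IsLoop G n c) where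
  open Distance G

  LoopPath : Fin n → Fin n → ℕ → Set
  LoopPath i j k = dist≤ G (c i) (c j) k × toℕ j ≡ toℕ i + k [mod n ]

  loopPath-refl : ∀ {i} → LoopPath i i 0
  loopPath-refl {i} = dist≤-refl , 0 , 0 , cong (_+ 0) (sym (+-identityʳ (toℕ i)))

  loopPath-step : ∀ {i j} → SuccMod n i j → LoopPath i j 1
  loopPath-step i→j = dist≤-step (loop _ _ i→j) , SuccMod⇒≡+1[mod] i→j

  loopPath-trans : ∀ {i j l k k′} → LoopPath i j k → LoopPath j l k′ → LoopPath i l (k + k′)
  loopPath-trans {i} {k = k} (d , e) (d′ , e′) = dist≤-trans d d′ , ≡+[mod]-trans {x = toℕ i} {a = k} e e′

module _ (G : Graph) {m : ℕ} (c : Fin (suc m) → V G) (loop : IsLoop G (suc m) c) where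
  open LoopPaths G c loop

  loopPath-forward : ∀ k i → LoopPath i (iterate sucMod i k) k
  loopPath-forward zero    i = loopPath-refl
  loopPath-forward (suc k) i = loopPath-trans (loopPath-step (SuccMod-sucMod i)) (loopPath-forward k (sucMod i))

  loopPath-backward : ∀ k i → LoopPath (fold i predMod k) i k
  loopPath-backward zero    i = loopPath-refl
  loopPath-backward (suc k) i =
    loopPath-trans (loopPath-step (SuccMod-predMod (fold i predMod k))) (loopPath-backward k i)

module Maximum {A : Set} {_≺_ : A → A → Set}
  (≺-trans : ∀ {x y z} → x ≺ y → y ≺ z → x ≺ z)
  (≺-trichot : ∀ x y → (x ≺ y) ⊎ (x ≡ y) ⊎ (y ≺ x)) where

  _≼_ : A → A → Set
  x ≼ y = (x ≺ y) ⊎ (x ≡ y)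

  ≼-trans : ∀ {x y z} → x ≼ y → y ≼ z → x ≼ z
  ≼-trans (inj₁ x≺y) (inj₁ y≺z)  = inj₁ (≺-trans x≺y y≺z)
  ≼-trans (inj₁ x≺y) (inj₂ refl) = inj₁ x≺y
  ≼-trans (inj₂ refl) y≼z        = y≼z

  argmax : ∀ {m} (f : Fin (suc m) → A) → ∃ λ i → ∀ j → f j ≼ f i
  argmax {zero} f = fzero , λ { fzero → inj₂ refl }
  argmax {suc m} f with argmax (λ j → f (fsuc j))
  ... | i , max with ≺-trichot (f fzero) (f (fsuc i))
  ... | inj₁ lt        = fsuc i , λ { fzero → inj₁ lt ; (fsuc j) → max j }
  ... | inj₂ (inj₁ eq) = fsuc i , λ { fzero → inj₂ eq ; (fsuc j) → max j }
  ... | inj₂ (inj₂ gt) = fzero , λ { fzero → inj₂ refl ; (fsuc j) → ≼-trans (max j) (inj₁ gt) }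

module _ {s s′ : ℕ} {G : Graph} (D : Dismantlable s s′ G) where
  open Distance G

  private
    _≺_ : V G → V G → Set
    _≺_ = proj₁ D
    order : IsWellOrder _≺_
    order = proj₁ (proj₂ D)
    open Maximum (IsWellOrder.trans order) (IsWellOrder.trichot order) using (_≼_)

  dist≤-via-dismantler : ∀ {v x y} → ∃ (λ w → w ≺ v) → x ≼ v → y ≼ v →
    dist≤ G v x s → dist≤ G v y s → dist≤ G x y (2 * s′)
  dist≤-via-dismantler {v} {x} {y} v-not-least x≼v y≼v vx vy
    with proj₂ (proj₂ D) v v-not-least
  ... | _ , _ , _ , contract =
    subst (dist≤ G x y) (cong (s′ +_) (sym (+-identityʳ s′)))
      (dist≤-trans (dist≤-sym (contract x x≼v vx)) (contract y y≼v vy))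

  dist≤-below-dismantled : ∀ {v x y} → x ≼ v → y ≼ v →
    dist≤ G v x s → dist≤ G v y s → dist≤ G x y (2 * s′)
  dist≤-below-dismantled (inj₁ x≺v) y≼v = dist≤-via-dismantler (_ , x≺v) (inj₁ x≺v) y≼v
  dist≤-below-dismantled x≼v (inj₁ y≺v) = dist≤-via-dismantler (_ , y≺v) x≼v (inj₁ y≺v)
  dist≤-below-dismantled (inj₂ refl) (inj₂ refl) _ _ = dist≤-refl

lemma1 : (s s′ : ℕ) → 0 < s′ → s′ < s → (G : Graph) → Dismantlable s s′ G →
    (n : ℕ) → 2 * (s + s′) < n → (c : Fin n → V G) → IsLoop G n c →
    ∃ λ (p : Fin n) → ∃ λ (q : Fin n) →
      (toℕ q ≡ toℕ p + 2 * s [mod n ]) × dist≤ G (c p) (c q) (2 * s′)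
lemma1 s s′ _ _ G D@(_ , order , _) (suc m) _ c loop =
  p , q , subst (λ t → toℕ q ≡ toℕ p + t [mod suc m ]) s+s≡2s (proj₂ p→q) ,
  dist≤-below-dismantled {s} {s′} {G} D (top p) (top q) (dist≤-sym (proj₁ p→i)) (proj₁ i→q)
  where
  open Maximum (IsWellOrder.trans order) (IsWellOrder.trichot order) using (_≼_; argmax)
  open Distance G
  open LoopPaths G c loop
  i : Fin (suc m)
  i = proj₁ (argmax c)
  top : ∀ j → c j ≼ c i
  top = proj₂ (argmax c)
  p q : Fin (suc m)
  p = fold i predMod s
  q = iterate sucMod i s
  p→i : LoopPath p i s
  p→i = loopPath-backward G c loop s i
  i→q : LoopPath i q s
  i→q = loopPath-forward G c loop s i
  p→q : LoopPath p q (s + s)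
  p→q = loopPath-trans p→i i→q
  s+s≡2s : s + s ≡ 2 * s
  s+s≡2s = cong (s +_) (sym (+-identityʳ s))
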